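{- For all integers $p,q\ge 1$, the complete bipartite graph $K_{p,q}$ satisfies $$|\mathcal{L}_1(K_{p,q})| = 3^p + 3^q + 2^{p+q} - 2^{p+1} - 2^{q+1} + 1$$ and $$\mathrm{avg}_1(K_{p,q}) = 3 - \frac{2^{p+q}}{3^p + 3^q + 2^{p+q} - 2^{p+1} - 2^{q+1} + 1}.$$
   Context: Let $G=(V,E)$ be a finite connected graph with a fixed root vertex $v_0\in V$. For $M\in\mathbb{N}$, an $M$-Lipschitz mapping of $G$ is a map $f:V\to\mathbb{Z}$ with $f(v_0)=0$ and $|f(u)-f(v)|\le M$ for every edge $uv\in E$; the (finite) set of these is $\mathcal{L}_M(G)$. The range of $f$ is $\mathrm{rng}(f)=|\{f(v): v\in V\}|$. The average range is $\mathrm{avg}_M(G)=\frac{\sum_{f\in\mathcal{L}_M(G)}\mathrm{rng}(f)}{|\mathcal{L}_M(G)|}$. Both quantities in the claim do not depend on the choice of root in $K_{p,q}$ (the root may be taken in the part of size $p$). -}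

module Defs where

open import Data.Nat as ℕ using (ℕ; zero; suc; _<_; _<?_)
open import Data.Integer as ℤ using (ℤ; +_; +[1+_]; -[1+_]; ∣_∣; _-_)
open import Data.Integer.Properties using () renaming (_≟_ to _≟ℤ_)
open import Data.Rational as ℚ using (ℚ)
open import Data.Fin using (Fin; toℕ)
open import Data.Vec using (Vec; lookup; toList)
open import Data.List as L using (List; length; deduplicate; map)
open import Data.Nat.ListAction using (sum)
open import Data.Product using (_×_)
open import Data.Sum using (_⊎_)
open import Relation.Nullary using (¬_; does)
open import Relation.Nullary.Decidable using (⌊_⌋)
open import Relation.Binary.PropositionalEquality using (_≡_)
open import Data.List.Membership.Propositional using (_∈_)
open import Data.List.Relation.Unary.Unique.Propositional using (Unique)
open import Data.Bool using (true; false)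

record RootedGraph : Set₁ where
  field
    n    : ℕ
    Adj  : Fin n → Fin n → Set
    root : Fin n

open RootedGraph public

Map : RootedGraph → Set
Map G = Vec ℤ (n G)

IsLipschitz : ℕ → (G : RootedGraph) → Map G → Set
IsLipschitz M G f =
  (lookup f (root G) ≡ + 0) ×
  (∀ u v → Adj G u v → ∣ lookup f u - lookup f v ∣ ℕ.≤ M)

-- xs lists every M-Lipschitz mapping of G exactly once (so length xs = |L_M(G)|).
Enumerates : ℕ → (G : RootedGraph) → List (Map G) → Set
Enumerates M G xs = Unique xs × (∀ f → (f ∈ xs → IsLipschitz M G f) × (IsLipschitz M G f → f ∈ xs))

rng : ∀ {k} → Vec ℤ k → ℕ
rng f = length (deduplicate _≟ℤ_ (toList f))

-- Total division of integers into ℚ (value 0 when the denominator is 0;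
-- only used with nonzero denominators).
_/ℤ_ : ℤ → ℤ → ℚ
a /ℤ (+ zero)   = ℚ.0ℚ
a /ℤ +[1+ d ]   = a ℚ./ suc d
a /ℤ -[1+ d ]   = (ℤ.- a) ℚ./ suc d

average : ∀ {G : RootedGraph} → List (Map G) → ℚ
average xs = (+ sum (map rng xs)) /ℤ (+ length xs)

InFirst : ∀ {m} (p : ℕ) → Fin m → Set
InFirst p i = toℕ i < p

KAdj : (p q : ℕ) → Fin (p ℕ.+ q) → Fin (p ℕ.+ q) → Set
KAdj p q u v = (InFirst p u × ¬ InFirst p v) ⊎ (¬ InFirst p u × InFirst p v)

K : (p q : ℕ) → .{{ℕ.NonZero p}} → RootedGraph
K (suc p) q = record { n = suc p ℕ.+ q ; Adj = KAdj (suc p) q ; root = Fin.zero }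
  where open import Data.Fin as Fin using ()

-- Every vertex of one part of K_{p,q} is adjacent to every vertex of the other, and the
-- root (value 0) lies in the first part.  So a 1-Lipschitz map is a choice of values on
-- both parts such that each value on the first part is within 1 of each value on the
-- second; the second part then lives in {-1,0,1} and the first in {-2,...,2}.  Fixing the
-- first part vertex by vertex, the number of admissible second parts only depends on the
-- set S ⊆ {-1,0,1} of values still allowed there; this gives a linear recursion over the
-- intervals S, solved in closed form.
--
-- For the average: K_{p,q} has diameter two, so the image of a 1-Lipschitz map is an
-- integer interval containing 0 with at most three elements.  Hence
--   rng f = 3 - [image ⊆ {0,1}] - [image ⊆ {-1,0}],
-- and each indicator sums to 2^{p+q-1}, since every map into {0,1} (or {-1,0}) sending the
-- root to 0 is 1-Lipschitz.  Thus the ranges sum to 3|L_1| - 2^{p+q}.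

module Submission where

open import Defs
open import Data.Nat using (ℕ; NonZero)
open import Data.Integer using (ℤ; +_; _+_; _-_; _^_)
open import Data.Rational using (ℚ) renaming (_-_ to _-ℚ_)
open import Data.List using (List; length)
open import Data.Product using (Σ; _×_)
open import Relation.Binary.PropositionalEquality using (_≡_)

open import Data.Bool using (Bool; true; false; if_then_else_; T; not; _∧_; _∨_)
open import Data.Bool.ListAction using (all)
open import Data.Bool.Properties using (⇔→≡; T-≡; ∨-identityʳ; ∨-zeroʳ; ∧-assoc)
open import Data.Empty using (⊥-elim; ⊥-elim-irr)
open import Data.Fin as Fin using (Fin; toℕ; _↑ˡ_; _↑ʳ_)
open import Data.Fin.Properties using (toℕ-↑ˡ; toℕ-↑ʳ; toℕ<n)
open import Data.Integer using (-[1+_]; ∣_∣; _*_; -_)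
import Data.Integer.Properties as ℤP
open import Data.Integer.Tactic.RingSolver using (solve-∀)
open import Data.List using ([]; _∷_; [_]; map; filter; filterᵇ; concatMap; cartesianProductWith; deduplicate)
import Data.List as List
open import Data.List.Membership.Propositional using (_∈_; lose)
open import Data.List.Membership.Propositional.Properties
  using (∈-map⁺; ∈-map⁻; ∈-filter⁺; ∈-filter⁻; ∈-concatMap⁺; ∈-concatMap⁻;
         ∈-cartesianProductWith⁺; ∈-cartesianProductWith⁻; deduplicate-∈⇔)
open import Data.List.Membership.Propositional.Properties.WithK using (unique∧set⇒bag)
open import Data.List.Properties using (map-++)
open import Data.List.Relation.Binary.BagAndSetEquality using (_∼[_]_; set; ∼bag⇒↭)
open import Data.List.Relation.Binary.Disjoint.Propositional using (Disjoint)
open import Data.List.Relation.Binary.Permutation.Propositional.Properties using (↭-length)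
open import Data.List.Relation.Unary.All as All using (All)
import Data.List.Relation.Unary.All.Properties as AllP
import Data.List.Relation.Unary.AllPairs as AllPairs
import Data.List.Relation.Unary.AllPairs.Properties as AllPairsP
open import Data.List.Relation.Unary.Any using (here; there; satisfied)
open import Data.List.Relation.Unary.Unique.Propositional using (Unique)
import Data.List.Relation.Unary.Unique.Propositional.Properties as UniqueP
open import Data.List.Relation.Unary.Unique.DecPropositional ℤP._≟_ using (unique?)
import Data.Nat as ℕ
open import Data.Nat using (zero; suc; _≤_; _<_; _≤?_; s≤s; z≤n)
open import Data.Nat.ListAction using (sum)
open import Data.Nat.ListAction.Properties using (sum-++)
import Data.Nat.Properties as ℕP
open import Algebra.Properties.CommutativeSemigroup ℕP.+-commutativeSemigroup using (interchange)
import Data.Rational as ℚ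
import Data.Rational.Properties as ℚP
import Data.Rational.Unnormalised as ℚᵘ
import Data.Rational.Unnormalised.Properties as ℚᵘP
open import Data.Product using (∃; _,_; proj₁; proj₂)
open import Data.Sum using (_⊎_; inj₁; inj₂)
open import Data.Vec using (Vec; []; _∷_; _++_; lookup; head; toList; splitAt; replicate)
open import Data.Vec.Membership.Propositional.Properties using (∈-lookup; ∈-toList⁺; ∈-toList⁻)
open import Data.Vec.Properties
  using (∷-injective; ∷-injectiveʳ; ++-injectiveˡ; ++-injectiveʳ; lookup-++-<; lookup-++-≥; lookup-++ˡ; lookup-++ʳ;
         toList-++; lookup-replicate)
import Data.Vec.Relation.Unary.All as VAll
import Data.Vec.Relation.Unary.All.Properties as VAllP
open import Data.Vec.Relation.Unary.Any using (index)
open import Data.Vec.Relation.Unary.Any.Properties using (lookup-index)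
open import Function using (_∘_)
open import Function.Bundles using (Equivalence; mk⇔)
open import Level using (0ℓ)
open import Relation.Binary.PropositionalEquality using (_≢_; refl; sym; trans; cong; cong₂; subst; subst₂; module ≡-Reasoning)
open import Relation.Nullary using (¬_; Dec; does; yes; no)
open import Relation.Nullary.Decidable using (from-yes)
open import Relation.Unary using (Pred; Decidable)
open import Relation.Binary.Definitions using (DecidableEquality)

private
  variable
    A B C : Set

∑ : List A → (A → ℕ) → ℕ
∑ xs g = sum (map g xs)

syntax ∑ xs (λ x → g) = ∑[ x ← xs ] g

⟦_⟧ : Bool → ℕ
⟦ b ⟧ = if b then 1 else 0

∑-cong : ∀ {g h : A → ℕ} xs → (∀ {x} → x ∈ xs → g x ≡ h x) → ∑ xs g ≡ ∑ xs h
∑-cong []       eq = refl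
∑-cong (x ∷ xs) eq = cong₂ ℕ._+_ (eq (here refl)) (∑-cong xs (eq ∘ there))

∑-++ : ∀ (g : A → ℕ) xs ys → ∑ (xs List.++ ys) g ≡ ∑ xs g ℕ.+ ∑ ys g
∑-++ g xs ys = trans (cong sum (map-++ g xs ys)) (sum-++ (map g xs) (map g ys))

∑-const : ∀ c (xs : List A) → ∑[ _ ← xs ] c ≡ length xs ℕ.* c
∑-const c []       = refl
∑-const c (x ∷ xs) = cong (c ℕ.+_) (∑-const c xs)

∑-if : ∀ b (g : A → ℕ) xs → ∑[ x ← xs ] (if b then g x else 0) ≡ (if b then ∑ xs g else 0)
∑-if true  g xs = refl
∑-if false g xs = trans (∑-const 0 xs) (ℕP.*-zeroʳ (length xs))

∑-+ : ∀ (g h : A → ℕ) xs → ∑[ x ← xs ] (g x ℕ.+ h x) ≡ ∑ xs g ℕ.+ ∑ xs h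
∑-+ g h []       = refl
∑-+ g h (x ∷ xs) = trans (cong (g x ℕ.+ h x ℕ.+_) (∑-+ g h xs)) (interchange (g x) (h x) (∑ xs g) (∑ xs h))

∑-map : ∀ (g : B → ℕ) (f : A → B) xs → ∑ (map f xs) g ≡ ∑[ x ← xs ] g (f x)
∑-map g f []       = refl
∑-map g f (x ∷ xs) = cong (g (f x) ℕ.+_) (∑-map g f xs)

∑-concatMap : ∀ (g : B → ℕ) (f : A → List B) xs → ∑ (concatMap f xs) g ≡ ∑[ x ← xs ] ∑ (f x) g
∑-concatMap g f []       = refl
∑-concatMap g f (x ∷ xs) = trans (∑-++ g (f x) (concatMap f xs)) (cong (∑ (f x) g ℕ.+_) (∑-concatMap g f xs))

∑-cartesianProductWith : ∀ (g : C → ℕ) (f : A → B → C) xs ys →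
                         ∑ (cartesianProductWith f xs ys) g ≡ ∑[ x ← xs ] ∑[ y ← ys ] g (f x y)
∑-cartesianProductWith g f []       ys = refl
∑-cartesianProductWith g f (x ∷ xs) ys =
  trans (∑-++ g (map (f x) ys) _) (cong₂ ℕ._+_ (∑-map g (f x) ys) (∑-cartesianProductWith g f xs ys))

∑-filter : ∀ {P : Pred A 0ℓ} (P? : Decidable P) c xs →
           ∑[ x ← xs ] (if does (P? x) then c else 0) ≡ length (filter P? xs) ℕ.* c
∑-filter P? c []       = refl
∑-filter P? c (x ∷ xs) with does (P? x)
... | true  = cong (c ℕ.+_) (∑-filter P? c xs)
... | false = ∑-filter P? c xs

length-filter : ∀ {P : Pred A 0ℓ} (P? : Decidable P) xs → length (filter P? xs) ≡ ∑[ x ← xs ] ⟦ does (P? x) ⟧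
length-filter P? xs = sym (trans (∑-filter P? 1 xs) (ℕP.*-identityʳ _))

∧-if : ∀ b c {k} → (if b ∧ c then k else 0) ≡ (if b then (if c then k else 0) else 0)
∧-if true  c = refl
∧-if false c = refl

all-++ : ∀ (P : A → Bool) xs ys → all P (xs List.++ ys) ≡ all P xs ∧ all P ys
all-++ P []       ys = refl
all-++ P (x ∷ xs) ys = trans (cong (P x ∧_) (all-++ P xs ys)) (sym (∧-assoc (P x) _ _))

filter-∧ : ∀ {P Q R : Pred A 0ℓ} (P? : Decidable P) (Q? : Decidable Q) (R? : Decidable R) →
           (∀ y → does (R? y) ≡ does (P? y) ∧ does (Q? y)) → ∀ xs → filter R? xs ≡ filter Q? (filter P? xs)
filter-∧ P? Q? R? R≡P∧Q []       = refl
filter-∧ P? Q? R? R≡P∧Q (x ∷ xs) with does (R? x) | does (P? x) | R≡P∧Q x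
... | _ | false | refl = filter-∧ P? Q? R? R≡P∧Q xs
... | _ | true  | refl with does (Q? x)
...   | true  = cong (x ∷_) (filter-∧ P? Q? R? R≡P∧Q xs)
...   | false = filter-∧ P? Q? R? R≡P∧Q xs

concatMap-unique : ∀ {f : A → List B} {xs} → Unique xs → (∀ x → Unique (f x)) →
                   (∀ {x y} → x ≢ y → Disjoint (f x) (f y)) → Unique (concatMap f xs)
concatMap-unique {xs = xs} xs! f! f# =
  UniqueP.concat⁺ (AllP.map⁺ (All.universal f! xs)) (AllPairsP.map⁺ (AllPairs.map f# xs!))

module _ (_≟_ : DecidableEquality A) where
  open import Data.List.Membership.DecPropositional _≟_ using (_∈?_)
  open import Data.List.Relation.Unary.Unique.DecPropositional.Properties _≟_ using (deduplicate-!)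

  length-deduplicate : ∀ {U} l → Unique U → All (_∈ U) l → length (deduplicate _≟_ l) ≡ ∑[ u ← U ] ⟦ does (u ∈? l) ⟧
  length-deduplicate {U} l U! l⊆U =
    trans (↭-length (∼bag⇒↭ (unique∧set⇒bag (deduplicate-! l) (UniqueP.filter⁺ (_∈? l) U!) sameElements)))
          (length-filter (_∈? l) U)
    where
    sameElements : deduplicate _≟_ l ∼[ set ] filter (_∈? l) U
    sameElements = mk⇔
      (λ x∈ → let x∈l = Equivalence.from (deduplicate-∈⇔ _≟_) x∈ in ∈-filter⁺ (_∈? l) (All.lookup l⊆U x∈l) x∈l)
      (λ x∈ → Equivalence.to (deduplicate-∈⇔ _≟_) (proj₂ (∈-filter⁻ (_∈? l) {xs = U} x∈)))

  all-restrict : ∀ (P : A → Bool) {U} l → All (_∈ U) l → all P l ≡ all (λ u → P u ∨ not (does (u ∈? l))) U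
  all-restrict P {U} l l⊆U = ⇔→≡ {z = true} (mk⇔ (Equivalence.to T-≡ ∘ to ∘ Equivalence.from T-≡)
                                                   (Equivalence.to T-≡ ∘ from ∘ Equivalence.from T-≡))
    where
    Q : A → Bool
    Q u = P u ∨ not (does (u ∈? l))
    to : T (all P l) → T (all Q U)
    to Pl = AllP.all⁻ Q {xs = U} (All.tabulate λ {u} _ → P-or-absent u)
      where
      P-or-absent : ∀ u → T (Q u)
      P-or-absent u with u ∈? l
      ... | yes u∈l = subst T (sym (∨-identityʳ (P u))) (All.lookup (AllP.all⁺ P l Pl) u∈l)
      ... | no  _   = subst T (sym (∨-zeroʳ (P u))) _
    from : T (all Q U) → T (all P l)
    from QU = AllP.all⁻ P {xs = l} (All.tabulate λ {x} x∈l → P-if-present x x∈l (All.lookup (AllP.all⁺ Q U QU) (All.lookup l⊆U x∈l)))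
      where
      P-if-present : ∀ x → x ∈ l → T (Q x) → T (P x)
      P-if-present x x∈l Qx with x ∈? l
      ... | yes _   = subst T (∨-identityʳ (P x)) Qx
      ... | no  x∉l = ⊥-elim (x∉l x∈l)

vecs : List A → (n : ℕ) → List (Vec A n)
vecs S zero    = [ [] ]
vecs S (suc n) = cartesianProductWith _∷_ S (vecs S n)

∈-vecs⁺ : ∀ {S n} {v : Vec A n} → VAll.All (_∈ S) v → v ∈ vecs S n
∈-vecs⁺ VAll.[]             = here refl
∈-vecs⁺ (x∈S VAll.∷ v∈Sⁿ) = ∈-cartesianProductWith⁺ _∷_ x∈S (∈-vecs⁺ v∈Sⁿ)

∈-vecs⁻ : ∀ {S : List A} n {v} → v ∈ vecs S n → VAll.All (_∈ S) v
∈-vecs⁻ zero    (here refl) = VAll.[]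
∈-vecs⁻ {S = S} (suc n) v∈ with ∈-cartesianProductWith⁻ _∷_ S (vecs S n) v∈
... | x , w , x∈S , w∈ , refl = x∈S VAll.∷ ∈-vecs⁻ n w∈

vecs-unique : ∀ {S : List A} n → Unique S → Unique (vecs S n)
vecs-unique zero    S! = All.[] AllPairs.∷ AllPairs.[]
vecs-unique (suc n) S! = UniqueP.cartesianProductWith⁺ _∷_ ∷-injective S! (vecs-unique n S!)

∑-vecs : ∀ (S : List A) n g → ∑ (vecs S (suc n)) g ≡ ∑[ x ← S ] ∑[ v ← vecs S n ] g (x ∷ v)
∑-vecs S n g = ∑-cartesianProductWith g _∷_ S (vecs S n)

∑-vecs-all : ∀ (P : A → Bool) S n → ∑[ v ← vecs S n ] ⟦ all P (toList v) ⟧ ≡ length (filterᵇ P S) ℕ.^ n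
∑-vecs-all P S zero    = refl
∑-vecs-all P S (suc n) = begin
  ∑[ v ← vecs S (suc n) ] ⟦ all P (toList v) ⟧
    ≡⟨ ∑-vecs S n _ ⟩
  ∑[ x ← S ] ∑[ v ← vecs S n ] ⟦ P x ∧ all P (toList v) ⟧
    ≡⟨ ∑-cong S (λ {x} _ → trans (∑-cong (vecs S n) λ {v} _ → ∧-if (P x) (all P (toList v))) (∑-if (P x) _ (vecs S n))) ⟩
  ∑[ x ← S ] (if P x then ∑[ v ← vecs S n ] ⟦ all P (toList v) ⟧ else 0)
    ≡⟨ ∑-cong S (λ {x} _ → cong (λ c → if P x then c else 0) (∑-vecs-all P S n)) ⟩
  ∑[ x ← S ] (if P x then length (filterᵇ P S) ℕ.^ n else 0)
    ≡⟨ ∑-filter (Data.Bool.T? ∘ P) _ S ⟩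
  length (filterᵇ P S) ℕ.^ suc n
    ∎
  where open ≡-Reasoning

Near : ℤ → ℤ → Set
Near x y = ∣ x - y ∣ ≤ 1

near? : ∀ x y → Dec (Near x y)
near? x y = ∣ x - y ∣ ≤? 1

Near-sym : ∀ x y → Near x y → Near y x
Near-sym x y = subst (_≤ 1) (ℤP.∣i-j∣≡∣j-i∣ x y)

Near-triangle : ∀ x y z → Near z x → Near z y → ∣ x - y ∣ ≤ 2
Near-triangle x y z z~x z~y = begin
  ∣ x - y ∣                 ≡⟨ cong ∣_∣ (split x y z) ⟩
  ∣ (x - z) + (z - y) ∣     ≤⟨ ℤP.∣i+j∣≤∣i∣+∣j∣ (x - z) (z - y) ⟩
  ∣ x - z ∣ ℕ.+ ∣ z - y ∣   ≤⟨ ℕP.+-mono-≤ (Near-sym z x z~x) z~y ⟩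
  2                         ∎
  where
  open ℕP.≤-Reasoning
  split : ∀ x y z → x - y ≡ (x - z) + (z - y)
  split = solve-∀

[-1] [0] [1] [-1‥0] [0‥1] [-1‥1] [-2‥2] : List ℤ
[-1]   = -[1+ 0 ] ∷ []
[0]    = + 0 ∷ []
[1]    = + 1 ∷ []
[-1‥0] = -[1+ 0 ] ∷ + 0 ∷ []
[0‥1]  = + 0 ∷ + 1 ∷ []
[-1‥1] = -[1+ 0 ] ∷ + 0 ∷ + 1 ∷ []
[-2‥2] = -[1+ 1 ] ∷ -[1+ 0 ] ∷ + 0 ∷ + 1 ∷ + 2 ∷ []

open import Data.List.Membership.DecPropositional ℤP._≟_ using (_∈?_)

inside : List ℤ → ℤ → Bool
inside U y = does (y ∈? U)

[-2‥2]-unique : Unique [-2‥2]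
[-2‥2]-unique = from-yes (unique? [-2‥2])

[-1‥1]-unique : Unique [-1‥1]
[-1‥1]-unique = from-yes (unique? [-1‥1])

Near-0⇒∈[-1‥1] : ∀ y → Near (+ 0) y → y ∈ [-1‥1]
Near-0⇒∈[-1‥1] -[1+ 0 ]        _ = here refl
Near-0⇒∈[-1‥1] (+ 0)           _ = there (here refl)
Near-0⇒∈[-1‥1] (+ 1)           _ = there (there (here refl))
Near-0⇒∈[-1‥1] -[1+ suc _ ]    (s≤s ())
Near-0⇒∈[-1‥1] (+ suc (suc _)) (s≤s ())

∈[-1‥1]⇒Near-0 : ∀ {y} → y ∈ [-1‥1] → Near (+ 0) y
∈[-1‥1]⇒Near-0 (here refl)                 = s≤s z≤n
∈[-1‥1]⇒Near-0 (there (here refl))         = z≤n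
∈[-1‥1]⇒Near-0 (there (there (here refl))) = s≤s z≤n

∣x∣≤2⇒∈[-2‥2] : ∀ x → ∣ x - + 0 ∣ ≤ 2 → x ∈ [-2‥2]
∣x∣≤2⇒∈[-2‥2] -[1+ 1 ]              _ = here refl
∣x∣≤2⇒∈[-2‥2] -[1+ 0 ]              _ = there (here refl)
∣x∣≤2⇒∈[-2‥2] (+ 0)                 _ = there (there (here refl))
∣x∣≤2⇒∈[-2‥2] (+ 1)                 _ = there (there (there (here refl)))
∣x∣≤2⇒∈[-2‥2] (+ 2)                 _ = there (there (there (there (here refl))))
∣x∣≤2⇒∈[-2‥2] -[1+ suc (suc _) ]    (s≤s (s≤s ()))
∣x∣≤2⇒∈[-2‥2] (+ suc (suc (suc _))) (s≤s (s≤s ()))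

lookup-++-zero : ∀ {m n} (α : Vec A (suc m)) (β : Vec A n) → lookup (α ++ β) Fin.zero ≡ head α
lookup-++-zero (_ ∷ _) β = refl

↑ˡ-InFirst : ∀ {m} n (i : Fin m) → InFirst m (i ↑ˡ n)
↑ˡ-InFirst {m} n i = subst (_< m) (sym (toℕ-↑ˡ i n)) (toℕ<n i)

↑ʳ-¬InFirst : ∀ m {n} (j : Fin n) → ¬ InFirst m (m ↑ʳ j)
↑ʳ-¬InFirst m j = ℕP.≤⇒≯ (subst (m ≤_) (sym (toℕ-↑ʳ m j)) (ℕP.m≤m+n m (toℕ j)))

module _ {m n : ℕ} (α : Vec ℤ (suc m)) (β : Vec ℤ (suc n)) where

  lipschitz-K⇒ : IsLipschitz 1 (K (suc m) (suc n)) (α ++ β) →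
                 head α ≡ + 0 × (∀ i j → Near (lookup α i) (lookup β j))
  lipschitz-K⇒ (root≡0 , edge) =
    trans (sym (lookup-++-zero α β)) root≡0 ,
    λ i j → subst₂ Near (lookup-++ˡ α β i) (lookup-++ʳ α β j)
                        (edge (i ↑ˡ suc n) (suc m ↑ʳ j) (inj₁ (↑ˡ-InFirst (suc n) i , ↑ʳ-¬InFirst (suc m) j)))

  lipschitz-K⇐ : head α ≡ + 0 → (∀ i j → Near (lookup α i) (lookup β j)) →
                 IsLipschitz 1 (K (suc m) (suc n)) (α ++ β)
  lipschitz-K⇐ head≡0 α~β = trans (lookup-++-zero α β) head≡0 , edge
    where
    across : ∀ u v → InFirst (suc m) u → ¬ InFirst (suc m) v → Near (lookup (α ++ β) u) (lookup (α ++ β) v)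
    across u v u∈A v∉A = subst₂ Near (sym (lookup-++-< α β u u∈A)) (sym (lookup-++-≥ α β v (ℕP.≮⇒≥ v∉A))) (α~β _ _)
    edge : ∀ u v → KAdj (suc m) (suc n) u v → Near (lookup (α ++ β) u) (lookup (α ++ β) v)
    edge u v (inj₁ (u∈A , v∉A)) = across u v u∈A v∉A
    edge u v (inj₂ (u∉A , v∈A)) = Near-sym (lookup (α ++ β) v) (lookup (α ++ β) u) (across v u v∈A u∉A)

K-diameter-two : ∀ {m n} (u v : Fin (suc m ℕ.+ suc n)) →
                 KAdj (suc m) (suc n) u v ⊎ ∃ λ w → KAdj (suc m) (suc n) w u × KAdj (suc m) (suc n) w v
K-diameter-two {m} {n} u v with toℕ u ℕ.<? suc m | toℕ v ℕ.<? suc m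
... | yes u∈A | no  v∉A = inj₁ (inj₁ (u∈A , v∉A))
... | no  u∉A | yes v∈A = inj₁ (inj₂ (u∉A , v∈A))
... | no  u∉A | no  v∉A = inj₂ (Fin.zero , inj₁ (s≤s z≤n , u∉A) , inj₁ (s≤s z≤n , v∉A))
... | yes u∈A | yes v∈A =
  inj₂ (suc m ↑ʳ Fin.zero , inj₂ (↑ʳ-¬InFirst (suc m) Fin.zero , u∈A) , inj₂ (↑ʳ-¬InFirst (suc m) Fin.zero , v∈A))

module LipschitzImage {m n} (f : Vec ℤ (suc m ℕ.+ suc n)) (f-lip : IsLipschitz 1 (K (suc m) (suc n)) f) where

  private
    value : ∀ u → lookup f u ∈ toList f
    value u = ∈-toList⁺ (∈-lookup u f)

    vertex : ∀ {x} → x ∈ toList f → ∃ λ u → lookup f u ≡ x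
    vertex x∈ = let p = ∈-toList⁻ x∈ in index p , sym (lookup-index p)

    edge : ∀ {u v} → KAdj (suc m) (suc n) u v → Near (lookup f u) (lookup f v)
    edge = proj₂ f-lip _ _

  two-step : ∀ {x y} → x ∈ toList f → y ∈ toList f → Near x y ⊎ ∃ λ z → z ∈ toList f × Near z x × Near z y
  two-step x∈ y∈ with vertex x∈ | vertex y∈
  ... | u , refl | v , refl with K-diameter-two u v
  ...   | inj₁ u~v            = inj₁ (edge u~v)
  ...   | inj₂ (w , w~u , w~v) = inj₂ (lookup f w , value w , edge w~u , edge w~v)

  0∈image : + 0 ∈ toList f
  0∈image = subst (_∈ toList f) (proj₁ f-lip) (value Fin.zero)

  diameter≤2 : ∀ {x y} → x ∈ toList f → y ∈ toList f → ∣ x - y ∣ ≤ 2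
  diameter≤2 x∈ y∈ with two-step x∈ y∈
  ... | inj₁ x~y                 = ℕP.m≤n⇒m≤1+n x~y
  ... | inj₂ (z , _ , z~x , z~y) = Near-triangle _ _ z z~x z~y

  image⊆[-2‥2] : All (_∈ [-2‥2]) (toList f)
  image⊆[-2‥2] = All.tabulate λ {x} x∈ → ∣x∣≤2⇒∈[-2‥2] x (diameter≤2 x∈ 0∈image)

  -2∈⇒-1∈ : -[1+ 1 ] ∈ toList f → -[1+ 0 ] ∈ toList f
  -2∈⇒-1∈ -2∈ with two-step -2∈ 0∈image
  ... | inj₁ (s≤s ())
  ... | inj₂ (z , z∈ , z~-2 , z~0) with Near-0⇒∈[-1‥1] z (Near-sym z (+ 0) z~0)
  ...   | here refl                 = z∈
  ...   | there (here refl)         = ⊥-elim (ℕP.m+1+n≰m 1 z~-2)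
  ...   | there (there (here refl)) = ⊥-elim (ℕP.m+1+n≰m 1 z~-2)

  2∈⇒1∈ : + 2 ∈ toList f → + 1 ∈ toList f
  2∈⇒1∈ 2∈ with two-step 2∈ 0∈image
  ... | inj₁ (s≤s ())
  ... | inj₂ (z , z∈ , z~2 , z~0) with Near-0⇒∈[-1‥1] z (Near-sym z (+ 0) z~0)
  ...   | here refl                 = ⊥-elim (ℕP.m+1+n≰m 1 z~2)
  ...   | there (here refl)         = ⊥-elim (ℕP.m+1+n≰m 1 z~2)
  ...   | there (there (here refl)) = z∈

  ¬-2∈×1∈ : ¬ (-[1+ 1 ] ∈ toList f × + 1 ∈ toList f)
  ¬-2∈×1∈ (-2∈ , 1∈) = ℕP.m+1+n≰m 2 (diameter≤2 -2∈ 1∈)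

  ¬-1∈×2∈ : ¬ (-[1+ 0 ] ∈ toList f × + 2 ∈ toList f)
  ¬-1∈×2∈ (-1∈ , 2∈) = ℕP.m+1+n≰m 2 (diameter≤2 -1∈ 2∈)

NearAll : ∀ {k} → Vec ℤ k → ℤ → Set
NearAll a y = VAll.All (λ x → Near x y) a

nearAll? : ∀ {k} (a : Vec ℤ k) → Decidable (NearAll a)
nearAll? a y = VAll.all? (λ x → near? x y) a

commonNear : ∀ {k} → List ℤ → Vec ℤ k → List ℤ
commonNear S a = filter (nearAll? a) S

commonNear-∷ : ∀ {k} S x (a : Vec ℤ k) → commonNear S (x ∷ a) ≡ commonNear (filter (near? x) S) a
commonNear-∷ S x a = filter-∧ (near? x) (nearAll? a) (nearAll? (x ∷ a)) (λ _ → refl) S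

-- + 0 ∷ a are the values on the first part (root first); those on the second part are near all of them.
extensions : ∀ {m} n → Vec ℤ m → List (Vec ℤ (suc m ℕ.+ suc n))
extensions n a = map ((+ 0 ∷ a) ++_) (vecs (commonNear [-1‥1] a) (suc n))

lipschitzMaps : ∀ m n → List (Vec ℤ (suc m ℕ.+ suc n))
lipschitzMaps m n = concatMap (extensions n) (vecs [-2‥2] m)

module _ (m n : ℕ) where

  lipschitzMaps-sound : ∀ f → f ∈ lipschitzMaps m n → IsLipschitz 1 (K (suc m) (suc n)) f
  lipschitzMaps-sound f f∈ with satisfied (∈-concatMap⁻ (extensions n) {xs = vecs [-2‥2] m} f∈)
  ... | a , f∈ₐ with ∈-map⁻ ((+ 0 ∷ a) ++_) f∈ₐ
  ... | b , b∈ , refl = lipschitz-K⇐ (+ 0 ∷ a) b refl nearAll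
    where
    b∈commonNear : ∀ j → lookup b j ∈ commonNear [-1‥1] a
    b∈commonNear j = VAllP.lookup⁺ (∈-vecs⁻ (suc n) b∈) j
    nearAll : ∀ i j → Near (lookup (+ 0 ∷ a) i) (lookup b j)
    nearAll Fin.zero    j = ∈[-1‥1]⇒Near-0 (proj₁ (∈-filter⁻ (nearAll? a) (b∈commonNear j)))
    nearAll (Fin.suc i) j = VAllP.lookup⁺ (proj₂ (∈-filter⁻ (nearAll? a) (b∈commonNear j))) i

  lipschitzMaps-complete : ∀ f → IsLipschitz 1 (K (suc m) (suc n)) f → f ∈ lipschitzMaps m n
  lipschitzMaps-complete f f-lip with splitAt (suc m) f
  ... | x ∷ a , b , refl with lipschitz-K⇒ (x ∷ a) b f-lip
  ... | refl , nearAll =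
    ∈-concatMap⁺ (extensions n) (lose (∈-vecs⁺ a∈[-2‥2]) (∈-map⁺ ((+ 0 ∷ a) ++_) (∈-vecs⁺ b∈commonNear)))
    where
    b~0 : ∀ j → Near (lookup b j) (+ 0)
    b~0 j = Near-sym (+ 0) (lookup b j) (nearAll Fin.zero j)
    a∈[-2‥2] : VAll.All (_∈ [-2‥2]) a
    a∈[-2‥2] = VAllP.lookup⁻ λ i → ∣x∣≤2⇒∈[-2‥2] (lookup a i)
      (Near-triangle (lookup a i) (+ 0) (lookup b Fin.zero) (Near-sym (lookup a i) _ (nearAll (Fin.suc i) Fin.zero)) (b~0 Fin.zero))
    b∈commonNear : VAll.All (_∈ commonNear [-1‥1] a) b
    b∈commonNear = VAllP.lookup⁻ λ j →
      ∈-filter⁺ (nearAll? a) (Near-0⇒∈[-1‥1] (lookup b j) (nearAll Fin.zero j)) (VAllP.lookup⁻ λ i → nearAll (Fin.suc i) j)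

  lipschitzMaps-unique : Unique (lipschitzMaps m n)
  lipschitzMaps-unique = concatMap-unique (vecs-unique m [-2‥2]-unique) extensions-unique extensions-disjoint
    where
    extensions-unique : ∀ a → Unique (extensions n a)
    extensions-unique a = UniqueP.map⁺ (++-injectiveʳ (+ 0 ∷ a) (+ 0 ∷ a))
                                       (vecs-unique (suc n) (UniqueP.filter⁺ (nearAll? a) [-1‥1]-unique))
    extensions-disjoint : ∀ {a a'} → a ≢ a' → Disjoint (extensions n a) (extensions n a')
    extensions-disjoint a≢a' (f∈ , f∈') with ∈-map⁻ _ f∈ | ∈-map⁻ _ f∈'
    ... | _ , _ , refl | _ , _ , eq = a≢a' (∷-injectiveʳ (++-injectiveˡ _ _ eq))

_⊆ᵇ_ : (ℤ → Bool) → List ℤ → Bool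
b ⊆ᵇ V = all (λ u → inside V u ∨ not (b u)) [-2‥2]

-- The hypotheses on the membership test b leave exactly the six intervals around 0 with at most three elements.
range-identity-bits : (b : ℤ → Bool) → T (b (+ 0)) → (T (b -[1+ 1 ]) → T (b -[1+ 0 ])) → (T (b (+ 2)) → T (b (+ 1))) →
  ¬ (T (b -[1+ 1 ]) × T (b (+ 1))) → ¬ (T (b -[1+ 0 ]) × T (b (+ 2))) →
  ∑[ u ← [-2‥2] ] ⟦ b u ⟧ ℕ.+ ⟦ b ⊆ᵇ [0‥1] ⟧ ℕ.+ ⟦ b ⊆ᵇ [-1‥0] ⟧ ≡ 3
range-identity-bits b b₀ b₋₂⇒b₋₁ b₂⇒b₁ ¬b₋₂b₁ ¬b₋₁b₂ with b -[1+ 1 ] | b -[1+ 0 ] | b (+ 0) | b (+ 1) | b (+ 2)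
... | false | false | true  | false | false = refl
... | false | true  | true  | false | false = refl
... | true  | true  | true  | false | false = refl
... | false | false | true  | true  | false = refl
... | false | false | true  | true  | true  = refl
... | false | true  | true  | true  | false = refl
... | _     | _     | false | _     | _     = ⊥-elim b₀
... | true  | false | _     | _     | _     = ⊥-elim (b₋₂⇒b₋₁ _)
... | _     | _     | _     | false | true  = ⊥-elim (b₂⇒b₁ _)
... | true  | _     | _     | true  | _     = ⊥-elim (¬b₋₂b₁ _)
... | _     | true  | _     | _     | true  = ⊥-elim (¬b₋₁b₂ _)

range-identity : ∀ {m n} (f : Vec ℤ (suc m ℕ.+ suc n)) → IsLipschitz 1 (K (suc m) (suc n)) f →
                 rng f ℕ.+ ⟦ all (inside [0‥1]) (toList f) ⟧ ℕ.+ ⟦ all (inside [-1‥0]) (toList f) ⟧ ≡ 3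
range-identity f f-lip = begin
  rng f ℕ.+ ⟦ all (inside [0‥1]) l ⟧ ℕ.+ ⟦ all (inside [-1‥0]) l ⟧
    ≡⟨ cong₂ ℕ._+_ (cong₂ ℕ._+_ (length-deduplicate ℤP._≟_ l [-2‥2]-unique image⊆[-2‥2])
                                 (cong ⟦_⟧ (all-restrict ℤP._≟_ (inside [0‥1]) l image⊆[-2‥2])))
                   (cong ⟦_⟧ (all-restrict ℤP._≟_ (inside [-1‥0]) l image⊆[-2‥2])) ⟩
  ∑[ u ← [-2‥2] ] ⟦ b u ⟧ ℕ.+ ⟦ b ⊆ᵇ [0‥1] ⟧ ℕ.+ ⟦ b ⊆ᵇ [-1‥0] ⟧
    ≡⟨ range-identity-bits b (present 0∈image) (present ∘ -2∈⇒-1∈ ∘ witness) (present ∘ 2∈⇒1∈ ∘ witness)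
                           (λ (p , q) → ¬-2∈×1∈ (witness p , witness q)) (λ (p , q) → ¬-1∈×2∈ (witness p , witness q)) ⟩
  3 ∎
  where
  open ≡-Reasoning
  open LipschitzImage f f-lip
  l : List ℤ
  l = toList f
  b : ℤ → Bool
  b u = does (u ∈? l)
  present : ∀ {u} → u ∈ l → T (does (u ∈? l))
  present {u} u∈l with u ∈? l
  ... | yes _   = _
  ... | no  u∉l = u∉l u∈l
  witness : ∀ {u} → T (does (u ∈? l)) → u ∈ l
  witness {u} t with u ∈? l
  ... | yes u∈l = u∈l

pos-^ : ∀ m k → + (m ℕ.^ k) ≡ (+ m) ^ k
pos-^ m zero    = refl
pos-^ m (suc k) = trans (ℤP.pos-* m (m ℕ.^ k)) (cong (+ m *_) (pos-^ m k))

module Counting (n : ℕ) where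

  count : (ℤ → Bool) → List ℤ → ℕ → ℕ
  count P S k = ∑[ a ← vecs [-2‥2] k ] (if all P (toList a) then length (filterᵇ P (commonNear S a)) ℕ.^ suc n else 0)

  count-lipschitzMaps : ∀ m (P : ℤ → Bool) → P (+ 0) ≡ true →
                        ∑[ f ← lipschitzMaps m n ] ⟦ all P (toList f) ⟧ ≡ count P [-1‥1] m
  count-lipschitzMaps m P P0 = begin
    ∑[ f ← lipschitzMaps m n ] ⟦ all P (toList f) ⟧
      ≡⟨ ∑-concatMap _ (extensions n) (vecs [-2‥2] m) ⟩
    ∑[ a ← vecs [-2‥2] m ] ∑[ f ← extensions n a ] ⟦ all P (toList f) ⟧
      ≡⟨ ∑-cong (vecs [-2‥2] m) (λ {a} _ → trans (∑-map (λ f → ⟦ all P (toList f) ⟧) ((+ 0 ∷ a) ++_) (Bs a))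
                                                  (∑-cong (Bs a) (λ {b} _ → splitAll a b))) ⟩
    ∑[ a ← vecs [-2‥2] m ] ∑[ b ← Bs a ] (if all P (toList a) then ⟦ all P (toList b) ⟧ else 0)
      ≡⟨ ∑-cong (vecs [-2‥2] m) (λ {a} _ → trans (∑-if (all P (toList a)) (λ b → ⟦ all P (toList b) ⟧) (Bs a))
           (cong (λ c → if all P (toList a) then c else 0) (∑-vecs-all P (commonNear [-1‥1] a) (suc n)))) ⟩
    count P [-1‥1] m
      ∎
    where
    open ≡-Reasoning
    Bs : Vec ℤ m → List (Vec ℤ (suc n))
    Bs a = vecs (commonNear [-1‥1] a) (suc n)
    splitAll : ∀ (a : Vec ℤ m) (b : Vec ℤ (suc n)) →
               ⟦ all P (toList ((+ 0 ∷ a) ++ b)) ⟧ ≡ (if all P (toList a) then ⟦ all P (toList b) ⟧ else 0)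
    splitAll a b rewrite P0 | toList-++ a b | all-++ P (toList a) (toList b) = ∧-if (all P (toList a)) (all P (toList b))

  count-suc : ∀ P S k → count P S (suc k) ≡ ∑[ x ← [-2‥2] ] (if P x then count P (filter (near? x) S) k else 0)
  count-suc P S k = trans (∑-vecs [-2‥2] k _) (∑-cong [-2‥2] λ {x} _ →
    trans (∑-cong (vecs [-2‥2] k) λ {a} _ →
             trans (∧-if (P x) (all P (toList a)))
                   (cong (λ S′ → if P x then (if all P (toList a) then length (filterᵇ P S′) ℕ.^ suc n else 0) else 0)
                         (commonNear-∷ S x a)))
          (∑-if (P x) _ (vecs [-2‥2] k)))

  count-∅ : ∀ P k → count P [] k ≡ 0
  count-∅ P k = trans (∑-cong (vecs [-2‥2] k) (λ {a} _ → if-0 (all P (toList a)))) (∑-if false (λ _ → 0) (vecs [-2‥2] k))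
    where
    if-0 : ∀ b → (if b then 0 else 0) ≡ 0
    if-0 true  = refl
    if-0 false = refl

  +∑[-2‥2] : ∀ (g : ℤ → ℕ) → + ∑[ x ← [-2‥2] ] g x ≡ + g -[1+ 1 ] + (+ g -[1+ 0 ] + (+ g (+ 0) + (+ g (+ 1) + + g (+ 2))))
  +∑[-2‥2] g = pos-+₅ (g -[1+ 1 ]) (g -[1+ 0 ]) (g (+ 0)) (g (+ 1)) (g (+ 2))
    where
    pos-+₅ : ∀ a b c d e → + (a ℕ.+ (b ℕ.+ (c ℕ.+ (d ℕ.+ (e ℕ.+ 0))))) ≡ + a + (+ b + (+ c + (+ d + + e)))
    pos-+₅ a b c d e rewrite ℕP.+-identityʳ e =
      trans (ℤP.pos-+ a _) (cong (_+_ (+ a)) (trans (ℤP.pos-+ b _) (cong (_+_ (+ b))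
        (trans (ℤP.pos-+ c _) (cong (_+_ (+ c)) (ℤP.pos-+ d e))))))

  count-suc-ℤ : ∀ P S k {e₋₂ e₋₁ e₀ e₁ e₂ : ℤ} → let w = λ x → + (if P x then count P (filter (near? x) S) k else 0) in
                w -[1+ 1 ] ≡ e₋₂ → w -[1+ 0 ] ≡ e₋₁ → w (+ 0) ≡ e₀ → w (+ 1) ≡ e₁ → w (+ 2) ≡ e₂ →
                + count P S (suc k) ≡ e₋₂ + (e₋₁ + (e₀ + (e₁ + e₂)))
  count-suc-ℤ P S k h₋₂ h₋₁ h₀ h₁ h₂ =
    trans (cong +_ (count-suc P S k))
          (trans (+∑[-2‥2] (λ x → if P x then count P (filter (near? x) S) k else 0))
                 (cong₂ _+_ h₋₂ (cong₂ _+_ h₋₁ (cong₂ _+_ h₀ (cong₂ _+_ h₁ h₂)))))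

  count-zero-ℤ : ∀ P S → + count P S 0 ≡ (+ length (filterᵇ P (commonNear S []))) ^ suc n
  count-zero-ℤ P S = trans (cong +_ (ℕP.+-identityʳ _)) (pos-^ _ (suc n))

  count-∅-ℤ : ∀ P k → + count P [] k ≡ + 0
  count-∅-ℤ P k = cong +_ (count-∅ P k)

module ClosedForms (n : ℕ) where
  open Counting n

  everywhere : ℤ → Bool
  everywhere _ = true

  a₂ a₃ : ℤ
  a₂ = (+ 2) ^ suc n
  a₃ = (+ 3) ^ suc n

  pairCount fullCount : ℕ → ℤ
  pairCount k = (+ 2) ^ k * a₂ + + 2 * (+ 3) ^ k - + 2 * (+ 2) ^ k
  fullCount k = a₃ + + 2 * a₂ * ((+ 2) ^ k - + 1) + + 3 * (+ 3) ^ k - + 4 * (+ 2) ^ k + + 1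

  count-[-1] : ∀ k → + count everywhere [-1] k ≡ (+ 3) ^ k
  count-[-1] zero    = trans (count-zero-ℤ everywhere [-1]) (ℤP.^-zeroˡ (suc n))
  count-[-1] (suc k) = trans (count-suc-ℤ everywhere [-1] k (count-[-1] k) (count-[-1] k) (count-[-1] k) (count-∅-ℤ _ k) (count-∅-ℤ _ k))
                             (step ((+ 3) ^ k))
    where
    step : ∀ r → r + (r + (r + (+ 0 + + 0))) ≡ + 3 * r
    step = solve-∀

  count-[0] : ∀ k → + count everywhere [0] k ≡ (+ 3) ^ k
  count-[0] zero    = trans (count-zero-ℤ everywhere [0]) (ℤP.^-zeroˡ (suc n))
  count-[0] (suc k) = trans (count-suc-ℤ everywhere [0] k (count-∅-ℤ _ k) (count-[0] k) (count-[0] k) (count-[0] k) (count-∅-ℤ _ k))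
                            (step ((+ 3) ^ k))
    where
    step : ∀ r → + 0 + (r + (r + (r + + 0))) ≡ + 3 * r
    step = solve-∀

  count-[1] : ∀ k → + count everywhere [1] k ≡ (+ 3) ^ k
  count-[1] zero    = trans (count-zero-ℤ everywhere [1]) (ℤP.^-zeroˡ (suc n))
  count-[1] (suc k) = trans (count-suc-ℤ everywhere [1] k (count-∅-ℤ _ k) (count-∅-ℤ _ k) (count-[1] k) (count-[1] k) (count-[1] k))
                            (step ((+ 3) ^ k))
    where
    step : ∀ r → + 0 + (+ 0 + (r + (r + r))) ≡ + 3 * r
    step = solve-∀

  pair-base : ∀ a → a ≡ + 1 * a + + 2 * + 1 - + 2 * + 1
  pair-base = solve-∀

  count-[0‥1] : ∀ k → + count everywhere [0‥1] k ≡ pairCount k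
  count-[0‥1] zero    = trans (count-zero-ℤ everywhere [0‥1]) (pair-base a₂)
  count-[0‥1] (suc k) =
    trans (count-suc-ℤ everywhere [0‥1] k (count-∅-ℤ _ k) (count-[0] k) (count-[0‥1] k) (count-[0‥1] k) (count-[1] k))
          (step a₂ ((+ 2) ^ k) ((+ 3) ^ k))
    where
    step : ∀ a t r → + 0 + (r + ((t * a + + 2 * r - + 2 * t) + ((t * a + + 2 * r - + 2 * t) + r)))
                     ≡ + 2 * t * a + + 2 * (+ 3 * r) - + 2 * (+ 2 * t)
    step = solve-∀

  count-[-1‥0] : ∀ k → + count everywhere [-1‥0] k ≡ pairCount k
  count-[-1‥0] zero    = trans (count-zero-ℤ everywhere [-1‥0]) (pair-base a₂)
  count-[-1‥0] (suc k) =
    trans (count-suc-ℤ everywhere [-1‥0] k (count-[-1] k) (count-[-1‥0] k) (count-[-1‥0] k) (count-[0] k) (count-∅-ℤ _ k))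
          (step a₂ ((+ 2) ^ k) ((+ 3) ^ k))
    where
    step : ∀ a t r → r + ((t * a + + 2 * r - + 2 * t) + ((t * a + + 2 * r - + 2 * t) + (r + + 0)))
                     ≡ + 2 * t * a + + 2 * (+ 3 * r) - + 2 * (+ 2 * t)
    step = solve-∀

  count-[-1‥1] : ∀ k → + count everywhere [-1‥1] k ≡ fullCount k
  count-[-1‥1] zero    = trans (count-zero-ℤ everywhere [-1‥1]) (base a₂ a₃)
    where
    base : ∀ a b → b ≡ b + + 2 * a * (+ 1 - + 1) + + 3 * + 1 - + 4 * + 1 + + 1
    base = solve-∀
  count-[-1‥1] (suc k) =
    trans (count-suc-ℤ everywhere [-1‥1] k (count-[-1] k) (count-[-1‥0] k) (count-[-1‥1] k) (count-[0‥1] k) (count-[1] k))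
          (step a₂ a₃ ((+ 2) ^ k) ((+ 3) ^ k))
    where
    step : ∀ a b t r → r + ((t * a + + 2 * r - + 2 * t) + ((b + + 2 * a * (t - + 1) + + 3 * r - + 4 * t + + 1)
                                                           + ((t * a + + 2 * r - + 2 * t) + r)))
                       ≡ b + + 2 * a * (+ 2 * t - + 1) + + 3 * (+ 3 * r) - + 4 * (+ 2 * t) + + 1
    step = solve-∀

  doubling₀₁ : ∀ a t → + 0 + (+ 0 + (t * a + (t * a + + 0))) ≡ + 2 * t * a
  doubling₀₁ = solve-∀

  doubling₋₁₀ : ∀ a t → + 0 + (t * a + (t * a + (+ 0 + + 0))) ≡ + 2 * t * a
  doubling₋₁₀ = solve-∀

  count-[0‥1]-inside[0‥1] : ∀ k → + count (inside [0‥1]) [0‥1] k ≡ (+ 2) ^ k * a₂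
  count-[0‥1]-inside[0‥1] zero    = trans (count-zero-ℤ (inside [0‥1]) [0‥1]) (sym (ℤP.*-identityˡ a₂))
  count-[0‥1]-inside[0‥1] (suc k) =
    trans (count-suc-ℤ (inside [0‥1]) [0‥1] k refl refl (count-[0‥1]-inside[0‥1] k) (count-[0‥1]-inside[0‥1] k) refl)
          (doubling₀₁ a₂ ((+ 2) ^ k))

  count-[-1‥1]-inside[0‥1] : ∀ k → + count (inside [0‥1]) [-1‥1] k ≡ (+ 2) ^ k * a₂
  count-[-1‥1]-inside[0‥1] zero    = trans (count-zero-ℤ (inside [0‥1]) [-1‥1]) (sym (ℤP.*-identityˡ a₂))
  count-[-1‥1]-inside[0‥1] (suc k) =
    trans (count-suc-ℤ (inside [0‥1]) [-1‥1] k refl refl (count-[-1‥1]-inside[0‥1] k) (count-[0‥1]-inside[0‥1] k) refl)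
          (doubling₀₁ a₂ ((+ 2) ^ k))

  count-[-1‥0]-inside[-1‥0] : ∀ k → + count (inside [-1‥0]) [-1‥0] k ≡ (+ 2) ^ k * a₂
  count-[-1‥0]-inside[-1‥0] zero    = trans (count-zero-ℤ (inside [-1‥0]) [-1‥0]) (sym (ℤP.*-identityˡ a₂))
  count-[-1‥0]-inside[-1‥0] (suc k) =
    trans (count-suc-ℤ (inside [-1‥0]) [-1‥0] k refl (count-[-1‥0]-inside[-1‥0] k) (count-[-1‥0]-inside[-1‥0] k) refl refl)
          (doubling₋₁₀ a₂ ((+ 2) ^ k))

  count-[-1‥1]-inside[-1‥0] : ∀ k → + count (inside [-1‥0]) [-1‥1] k ≡ (+ 2) ^ k * a₂
  count-[-1‥1]-inside[-1‥0] zero    = trans (count-zero-ℤ (inside [-1‥0]) [-1‥1]) (sym (ℤP.*-identityˡ a₂))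
  count-[-1‥1]-inside[-1‥0] (suc k) =
    trans (count-suc-ℤ (inside [-1‥0]) [-1‥1] k refl (count-[-1‥0]-inside[-1‥0] k) (count-[-1‥1]-inside[-1‥0] k) refl refl)
          (doubling₋₁₀ a₂ ((+ 2) ^ k))

  length-lipschitzMaps : ∀ m → + length (lipschitzMaps m n) ≡
    (+ 3) ^ suc m + (+ 3) ^ suc n + (+ 2) ^ (suc m ℕ.+ suc n) - (+ 2) ^ (suc m ℕ.+ 1) - (+ 2) ^ (suc n ℕ.+ 1) + (+ 1)
  length-lipschitzMaps m = begin
    + length xs                                 ≡⟨ cong +_ (sym (trans (∑-const 1 xs) (ℕP.*-identityʳ _))) ⟩
    + ∑[ f ← xs ] 1                             ≡⟨ cong +_ (∑-cong xs (λ {f} _ → cong ⟦_⟧ (sym (all-everywhere (toList f))))) ⟩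
    + ∑[ f ← xs ] ⟦ all everywhere (toList f) ⟧ ≡⟨ cong +_ (count-lipschitzMaps m everywhere refl) ⟩
    + count everywhere [-1‥1] m                 ≡⟨ count-[-1‥1] m ⟩
    fullCount m                                 ≡⟨ regroup (cong (+ 2 *_) (ℤP.^-distribˡ-+-* (+ 2) m (suc n)))
                                                           (cong (+ 2 *_) (ℤP.^-distribˡ-+-* (+ 2) m 1))
                                                           (cong (+ 2 *_) (ℤP.^-distribˡ-+-* (+ 2) n 1)) ⟩
    (+ 3) ^ suc m + a₃ + (+ 2) ^ (suc m ℕ.+ suc n) - (+ 2) ^ (suc m ℕ.+ 1) - (+ 2) ^ (suc n ℕ.+ 1) + (+ 1) ∎
    where
    open ≡-Reasoning
    xs : List (Vec ℤ (suc m ℕ.+ suc n))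
    xs = lipschitzMaps m n
    all-everywhere : ∀ xs → all everywhere xs ≡ true
    all-everywhere []       = refl
    all-everywhere (x ∷ xs) = all-everywhere xs
    identity : ∀ t r u b → b + + 2 * (+ 2 * u) * (t - + 1) + + 3 * r - + 4 * t + + 1
                           ≡ + 3 * r + b + + 2 * (t * (+ 2 * u)) - + 2 * (t * (+ 2 * + 1)) - + 2 * (u * (+ 2 * + 1)) + + 1
    identity = solve-∀
    regroup : ∀ {x y z} → x ≡ + 2 * ((+ 2) ^ m * a₂) → y ≡ + 2 * ((+ 2) ^ m * (+ 2 * + 1)) → z ≡ + 2 * ((+ 2) ^ n * (+ 2 * + 1)) →
              fullCount m ≡ (+ 3) ^ suc m + a₃ + x - y - z + (+ 1)
    regroup refl refl refl = identity ((+ 2) ^ m) ((+ 3) ^ m) ((+ 2) ^ n) a₃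

  ∑-rng : ∀ m → + ∑[ f ← lipschitzMaps m n ] rng f + (+ 2) ^ (suc m ℕ.+ suc n) ≡ + 3 * + length (lipschitzMaps m n)
  ∑-rng m = begin
    + R + (+ 2) ^ (suc m ℕ.+ suc n)
      ≡⟨ cong (_+_ (+ R)) (trans (cong (+ 2 *_) (ℤP.^-distribˡ-+-* (+ 2) m (suc n))) (double _)) ⟩
    + R + ((+ 2) ^ m * a₂ + (+ 2) ^ m * a₂)
      ≡⟨ cong (_+_ (+ R)) (sym (cong₂ _+_ c₀₁≡ c₋₁₀≡)) ⟩
    + R + (+ c₀₁ + + c₋₁₀)
      ≡⟨ sym (ℤP.+-assoc (+ R) (+ c₀₁) (+ c₋₁₀)) ⟩
    + R + + c₀₁ + + c₋₁₀
      ≡⟨ sym (trans (ℤP.pos-+ (R ℕ.+ c₀₁) c₋₁₀) (cong (_+ + c₋₁₀) (ℤP.pos-+ R c₀₁))) ⟩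
    + (R ℕ.+ c₀₁ ℕ.+ c₋₁₀)
      ≡⟨ cong +_ total ⟩
    + (length xs ℕ.* 3)
      ≡⟨ trans (cong +_ (ℕP.*-comm (length xs) 3)) (ℤP.pos-* 3 (length xs)) ⟩
    + 3 * + length xs
      ∎
    where
    open ≡-Reasoning
    xs : List (Vec ℤ (suc m ℕ.+ suc n))
    xs = lipschitzMaps m n
    R c₀₁ c₋₁₀ : ℕ
    R     = ∑[ f ← xs ] rng f
    c₀₁   = ∑[ f ← xs ] ⟦ all (inside [0‥1]) (toList f) ⟧
    c₋₁₀  = ∑[ f ← xs ] ⟦ all (inside [-1‥0]) (toList f) ⟧
    double : ∀ x → + 2 * x ≡ x + x
    double = solve-∀
    c₀₁≡ : + c₀₁ ≡ (+ 2) ^ m * a₂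
    c₀₁≡ = trans (cong +_ (count-lipschitzMaps m (inside [0‥1]) refl)) (count-[-1‥1]-inside[0‥1] m)
    c₋₁₀≡ : + c₋₁₀ ≡ (+ 2) ^ m * a₂
    c₋₁₀≡ = trans (cong +_ (count-lipschitzMaps m (inside [-1‥0]) refl)) (count-[-1‥1]-inside[-1‥0] m)
    total : R ℕ.+ c₀₁ ℕ.+ c₋₁₀ ≡ length xs ℕ.* 3
    total = begin
      R ℕ.+ c₀₁ ℕ.+ c₋₁₀
        ≡⟨ cong (ℕ._+ c₋₁₀) (sym (∑-+ rng (λ f → ⟦ all (inside [0‥1]) (toList f) ⟧) xs)) ⟩
      ∑[ f ← xs ] (rng f ℕ.+ ⟦ all (inside [0‥1]) (toList f) ⟧) ℕ.+ c₋₁₀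
        ≡⟨ sym (∑-+ (λ f → rng f ℕ.+ ⟦ all (inside [0‥1]) (toList f) ⟧) (λ f → ⟦ all (inside [-1‥0]) (toList f) ⟧) xs) ⟩
      ∑[ f ← xs ] (rng f ℕ.+ ⟦ all (inside [0‥1]) (toList f) ⟧ ℕ.+ ⟦ all (inside [-1‥0]) (toList f) ⟧)
        ≡⟨ ∑-cong xs (λ {f} f∈ → range-identity f (lipschitzMaps-sound m n f f∈)) ⟩
      ∑[ _ ← xs ] 3
        ≡⟨ ∑-const 3 xs ⟩
      length xs ℕ.* 3
        ∎

/ℤ-complement : ∀ (k s t : ℤ) d → s + t ≡ k * + suc d → s /ℤ (+ suc d) ≡ (k /ℤ (+ 1)) -ℚ (t /ℤ (+ suc d))
/ℤ-complement k s t d s+t≡kx = ℚP.toℚᵘ-injective (begin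
  ℚ.toℚᵘ (s ℚ./ suc d)
    ≈⟨ normalize≃ s d ⟩
  ℚᵘ.mkℚᵘ s d
    ≈⟨ ℚᵘ.*≡* cross ⟩
  ℚᵘ.mkℚᵘ k 0 ℚᵘ.+ ℚᵘ.- ℚᵘ.mkℚᵘ t d
    ≈⟨ ℚᵘP.≃-sym (ℚᵘP.+-cong (normalize≃ k 0) (ℚᵘP.-‿cong (normalize≃ t d))) ⟩
  ℚ.toℚᵘ (k ℚ./ 1) ℚᵘ.+ ℚᵘ.- ℚ.toℚᵘ (t ℚ./ suc d)
    ≈⟨ ℚᵘP.+-congʳ (ℚ.toℚᵘ (k ℚ./ 1)) (ℚᵘP.≃-sym (ℚP.toℚᵘ-homo‿- (t ℚ./ suc d))) ⟩
  ℚ.toℚᵘ (k ℚ./ 1) ℚᵘ.+ ℚ.toℚᵘ (ℚ.- (t ℚ./ suc d))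
    ≈⟨ ℚᵘP.≃-sym (ℚP.toℚᵘ-homo-+ (k ℚ./ 1) (ℚ.- (t ℚ./ suc d))) ⟩
  ℚ.toℚᵘ ((k ℚ./ 1) -ℚ (t ℚ./ suc d))
    ∎)
  where
  open ℚᵘP.≃-Reasoning
  normalize≃ : ∀ i d → ℚ.toℚᵘ (i ℚ./ suc d) ℚᵘ.≃ ℚᵘ.mkℚᵘ i d
  normalize≃ i d = ℚP.toℚᵘ-fromℚᵘ (ℚᵘ.mkℚᵘ i d)
  x : ℤ
  x = + suc d
  rearrange : ∀ s t → s ≡ (s + t) + - t * + 1
  rearrange = solve-∀
  cross : s * + (1 ℕ.* suc d) ≡ (k * x + - t * + 1) * x
  cross = trans (cong (λ e → s * + e) (ℕP.*-identityˡ (suc d)))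
                (cong (_* x) (trans (rearrange s t) (cong (λ u → u + - t * + 1) s+t≡kx)))

length-nonzero : ∀ {x : A} {xs} → x ∈ xs → ∃ λ d → length xs ≡ suc d
length-nonzero {xs = _ ∷ xs} _ = length xs , refl

zero-map∈lipschitzMaps : ∀ m n → replicate (suc m) (+ 0) ++ replicate (suc n) (+ 0) ∈ lipschitzMaps m n
zero-map∈lipschitzMaps m n = lipschitzMaps-complete m n _ (lipschitz-K⇐ (replicate (suc m) (+ 0)) (replicate (suc n) (+ 0)) refl
  λ i j → subst₂ Near (sym (lookup-replicate i (+ 0))) (sym (lookup-replicate j (+ 0))) z≤n)

theorem2 : (p q : ℕ) → .{{_ : NonZero p}} → .{{_ : NonZero q}} →
    Σ (List (Map (K p q))) λ xs →
      Enumerates 1 (K p q) xs ×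
      (+ length xs ≡ (+ 3) ^ p + (+ 3) ^ q + (+ 2) ^ (p Data.Nat.+ q) - (+ 2) ^ (p Data.Nat.+ 1) - (+ 2) ^ (q Data.Nat.+ 1) + (+ 1)) ×
      (average {K p q} xs ≡ ((+ 3) /ℤ (+ 1)) -ℚ (((+ 2) ^ (p Data.Nat.+ q)) /ℤ ((+ 3) ^ p + (+ 3) ^ q + (+ 2) ^ (p Data.Nat.+ q) - (+ 2) ^ (p Data.Nat.+ 1) - (+ 2) ^ (q Data.Nat.+ 1) + (+ 1))))
theorem2 zero    q       {{p≢0}}          = ⊥-elim-irr (ℕ.NonZero.nonZero p≢0)
theorem2 (suc m) zero    {{_}}   {{q≢0}}  = ⊥-elim-irr (ℕ.NonZero.nonZero q≢0)
theorem2 (suc m) (suc n) =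
  xs , (lipschitzMaps-unique m n , λ f → lipschitzMaps-sound m n f , lipschitzMaps-complete m n f) ,
  length-lipschitzMaps m ,
  trans (average≡ (length-nonzero (zero-map∈lipschitzMaps m n))) (cong (λ N → ((+ 3) /ℤ (+ 1)) -ℚ (X /ℤ N)) (length-lipschitzMaps m))
  where
  open ClosedForms n
  xs : List (Vec ℤ (suc m ℕ.+ suc n))
  xs = lipschitzMaps m n
  X : ℤ
  X = (+ 2) ^ (suc m ℕ.+ suc n)
  average≡ : (∃ λ d → length xs ≡ suc d) → average {K (suc m) (suc n)} xs ≡ ((+ 3) /ℤ (+ 1)) -ℚ (X /ℤ (+ length xs))
  average≡ (d , len≡) rewrite len≡ = /ℤ-complement (+ 3) (+ ∑[ f ← xs ] rng f) X d (trans (∑-rng m) (cong (λ N → + 3 * + N) len≡))
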